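{- Let $K$ be a real closed field and $G\subseteq K^{>0}$ a divisible subgroup of the multiplicative group $K^{>0}$ which is tame and cofinal in $K^{>0}$. Let $K^\times=K\setminus\{0\}$ and let $G^{\mathrm{op}}$ be the ordered group obtained by reversing the order of $G$. The following are equivalent: (i) The map $v_G:K^\times\to G^{\mathrm{op}}$, $v_G(a)=\mathrm{st}(|a|)$, is an order-compatible valuation on $K$ (i.e. a surjective group homomorphism with $v_G(a+b)\ge\min\{v_G(a),v_G(b)\}$ in $G^{\mathrm{op}}$ whenever $a,b\in K^\times$, $a\ne -b$, and such that $0<a<b$ implies $v_G(b)\le v_G(a)$ in $G^{\mathrm{op}}$). (ii) $\mathrm{st}(|a+b|)\le\max\{\mathrm{st}(|a|),\mathrm{st}(|b|)\}$ in $G$ for all $a,b\in K^\times$ with $a\ne -b$. (iii) $\mathrm{st}(2)\le 1$. Moreover, if any of (i)–(iii) holds, then $G$ is a monomial group of the real closed valued field $(K,v_G)$ (i.e. $v_G|_G:G\to G^{\mathrm{op}}$ is a group isomorphism), and the corresponding convex valuation ring is $V_G=\{0\}\cup\{a\in K^\times\mid \mathrm{st}(|a|)\le 1\}$.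
   Context: $K^{>0}$ is regarded as a multiplicative totally ordered abelian group with the field order. $G$ is cofinal in $K^{>0}$ if every $r\in K^{>0}$ satisfies $r\le g$ for some $g\in G$; $G$ is tame in $K^{>0}$ if for every $r\in K^{>0}$ lying between two elements of $G$ there is $g\in G$ such that either $r=g$, or $r<g$ and no $g'\in G$ satisfies $r<g'<g$, or $g<r$ and no $g'\in G$ satisfies $g<g'<r$. Such $g$ is unique and denoted $\mathrm{st}(r)$; since $G$ is tame and cofinal this defines the standard part map $\mathrm{st}:K^{>0}\to G$. -}

module Defs where

open import Level using (Level; _⊔_; suc)
open import Data.Nat using (ℕ; zero) renaming (suc to sucℕ; _+_ to _+ℕ_)
open import Data.List using (List; []; _∷_; _++_; [_]; length)
open import Data.Product using (Σ; ∃; _×_; _,_)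
open import Data.Sum using (_⊎_)
open import Relation.Nullary using (¬_)
open import Relation.Binary.PropositionalEquality using (_≡_)
open import Relation.Binary.Structures using (IsStrictTotalOrder)
open import Relation.Binary.Definitions using (tri<; tri≈; tri>)
open import Algebra.Bundles using (CommutativeRing)

horner : ∀ {a} {A : Set a} → (A → A → A) → (A → A → A) → A → List A → A → A
horner _+_ _*_ z []       x = z
horner _+_ _*_ z (c ∷ cs) x = c + (x * horner _+_ _*_ z cs x)

-- A real closed field: a (totally) ordered field in which every positive element
-- has a square root and every monic polynomial of odd degree has a root.
record RealClosedField (c ℓ : Level) : Set (suc (c ⊔ ℓ)) where
  field
    commutativeRing : CommutativeRing c ℓ
  open CommutativeRing commutativeRing public
  field
    _<_                 : Carrier → Carrier → Set ℓ
    <-isStrictTotalOrder : IsStrictTotalOrder _≈_ _<_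
    +-mono-<  : ∀ {a b} (d : Carrier) → a < b → (a + d) < (b + d)
    *-pos     : ∀ {a b} → 0# < a → 0# < b → 0# < (a * b)
    1≉0       : ¬ (1# ≈ 0#)
    inverse   : ∀ a → ¬ (a ≈ 0#) → ∃ λ b → (a * b) ≈ 1#
    sqrt      : ∀ a → 0# < a → ∃ λ b → (b * b) ≈ a
    odd-root  : ∀ (cs : List Carrier) → (∃ λ n → length cs ≡ sucℕ (n +ℕ n)) →
                ∃ λ x → horner _+_ _*_ 0# (cs ++ [ 1# ]) x ≈ 0#

  open IsStrictTotalOrder <-isStrictTotalOrder public using (compare)

  _≤_ : Carrier → Carrier → Set ℓ
  a ≤ b = (a < b) ⊎ (a ≈ b)

  ∣_∣ : Carrier → Carrier
  ∣ a ∣ with compare a 0#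
  ... | tri< _ _ _ = - a
  ... | tri≈ _ _ _ = a
  ... | tri> _ _ _ = a

  2# : Carrier
  2# = 1# + 1#

  max : Carrier → Carrier → Carrier
  max g h with compare g h
  ... | tri< _ _ _ = h
  ... | tri≈ _ _ _ = g
  ... | tri> _ _ _ = g

  _^_ : Carrier → ℕ → Carrier
  a ^ zero    = 1#
  a ^ sucℕ n  = a * (a ^ n)

record Subgroup {c ℓ} (K : RealClosedField c ℓ) (p : Level) : Set (c ⊔ ℓ ⊔ suc p) where
  open RealClosedField K
  field
    _∈G       : Carrier → Set p
    ∈-resp-≈  : ∀ {a b} → a ≈ b → a ∈G → b ∈G
    ∈⇒pos     : ∀ {g} → g ∈G → 0# < g
    1∈        : 1# ∈G
    *-closed  : ∀ {g h} → g ∈G → h ∈G → (g * h) ∈G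
    inv-closed : ∀ {g} → g ∈G → ∃ λ h → h ∈G × (g * h) ≈ 1#

module _ {c ℓ p} (K : RealClosedField c ℓ) (G : Subgroup K p) where
  open RealClosedField K
  open Subgroup G

  Divisible : Set (c ⊔ ℓ ⊔ p)
  Divisible = ∀ g → g ∈G → ∀ (n : ℕ) → ∃ λ h → h ∈G × (h ^ sucℕ n) ≈ g

  Cofinal : Set (c ⊔ ℓ ⊔ p)
  Cofinal = ∀ r → 0# < r → ∃ λ g → g ∈G × r ≤ g

  -- g = st(r): g ∈ G and r = g, or g is the immediate G-successor / G-predecessor of r.
  IsSt : Carrier → Carrier → Set (c ⊔ ℓ ⊔ p)
  IsSt r g = g ∈G ×
    ( (r ≈ g)
    ⊎ ((r < g) × (∀ g' → g' ∈G → ¬ ((r < g') × (g' < g))))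
    ⊎ ((g < r) × (∀ g' → g' ∈G → ¬ ((g < g') × (g' < r)))) )

  Tame : Set (c ⊔ ℓ ⊔ p)
  Tame = ∀ r → 0# < r → ∀ g₁ g₂ → g₁ ∈G → g₂ ∈G → g₁ ≤ r → r ≤ g₂ → ∃ λ g → IsSt r g

  vG : Carrier → Carrier → Set (c ⊔ ℓ ⊔ p)
  vG a g = IsSt ∣ a ∣ g

  _≤op_ : Carrier → Carrier → Set ℓ
  g ≤op h = h ≤ g

  minOp : Carrier → Carrier → Carrier
  minOp g h with compare g h
  ... | tri< _ _ _ = h
  ... | tri≈ _ _ _ = g
  ... | tri> _ _ _ = g

  CondI : Set (c ⊔ ℓ ⊔ p)
  CondI =
    (∀ a b g h k → a ≉ 0# → b ≉ 0# → vG a g → vG b h → vG (a * b) k → k ≈ (g * h))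
    × (∀ g → g ∈G → ∃ λ a → a ≉ 0# × vG a g)
    × (∀ a b g h k → a ≉ 0# → b ≉ 0# → a ≉ (- b) → vG a g → vG b h → vG (a + b) k →
         minOp g h ≤op k)
    × (∀ a b g h → 0# < a → a < b → vG a g → vG b h → h ≤op g)

  CondII : Set (c ⊔ ℓ ⊔ p)
  CondII = ∀ a b g h k → a ≉ 0# → b ≉ 0# → a ≉ (- b) →
             IsSt ∣ a ∣ g → IsSt ∣ b ∣ h → IsSt ∣ a + b ∣ k → k ≤ max g h

  CondIII : Set (c ⊔ ℓ ⊔ p)
  CondIII = ∀ g → IsSt 2# g → g ≤ 1#

  Monomial : Set (c ⊔ ℓ ⊔ p)
  Monomial =
    (∀ g → g ∈G → ∃ λ k → vG g k)
    × (∀ g g' k k' m → g ∈G → g' ∈G → vG g k → vG g' k' → vG (g * g') m → m ≈ (k * k'))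
    × (∀ g g' k → g ∈G → g' ∈G → vG g k → vG g' k → g ≈ g')
    × (∀ h → h ∈G → ∃ λ g → g ∈G × vG g h)

  VG : Carrier → Set (c ⊔ ℓ ⊔ p)
  VG a = (a ≈ 0#) ⊎ ((a ≉ 0#) × (∀ g → IsSt ∣ a ∣ g → g ≤ 1#))

  ValRing : Carrier → Set (c ⊔ ℓ ⊔ p)
  ValRing a = (a ≈ 0#) ⊎ ((a ≉ 0#) × (∀ g → vG a g → 1# ≤op g))

  IsConvexValuationRing : (Carrier → Set (c ⊔ ℓ ⊔ p)) → Set (c ⊔ ℓ ⊔ p)
  IsConvexValuationRing V =
    (∀ {a b} → a ≈ b → V a → V b)
    × V 0# × V 1#
    × (∀ a b → V a → V b → V (a + b))
    × (∀ a → V a → V (- a))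
    × (∀ a b → V a → V b → V (a * b))
    × (∀ a → a ≉ 0# → V a ⊎ (∀ b → (a * b) ≈ 1# → V b))
    × (∀ a b → 0# ≤ a → a ≤ b → V b → V a)

-- Because G is divisible, every gap g < g' in G has the form g' = g·u² with 1 < u ∈ G, and
-- st(r) is the unique g ∈ G with r < g·u and g < r·u for every u > 1 in G. This
-- characterisation is multiplicative and monotone, so v_G is always a surjective homomorphism,
-- antitone on K^{>0}; condition (i) therefore amounts to the ultrametric inequality (ii).
-- Taking a = b = 1 in (ii) gives (iii). Conversely st(2) ≤ 1 means 2 < w for every w > 1 in G;
-- with m = max(st|a|, st|b|) this gives |a + b| ≤ |a| + |b| < 2·m·w < m·w² for all such w,
-- which forces st|a + b| ≤ m. The valuation ring axioms for V_G follow from (ii),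
-- multiplicativity and antitonicity.
module Submission where

open import Defs
open import Level using (_⊔_)
open import Data.Product using (_×_; _,_; proj₁; proj₂; ∃)
open import Data.Sum using (_⊎_; inj₁; inj₂)
open import Data.Empty using (⊥-elim)
open import Function using (id; _∘_)
open import Relation.Nullary using (¬_; yes; no)
open import Relation.Binary.PropositionalEquality as ≡ using (_≡_)
open import Relation.Binary.Bundles using (StrictPartialOrder)
open import Relation.Binary.Structures using (IsStrictTotalOrder)
open import Relation.Binary.Definitions using (tri<; tri≈; tri>)
import Relation.Binary.Construct.StrictToNonStrict as StrictToNonStrict
import Relation.Binary.Reasoning.StrictPartialOrder as StrictPartialOrderReasoning
import Algebra.Properties.Ring as RingProperties
import Algebra.Solver.Ring.NaturalCoefficients.Default as SemiringSolver

module OrderedFieldProperties {c ℓ} (K : RealClosedField c ℓ) where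
  open RealClosedField K renaming (+-mono-< to +-monoˡ-<)
  open IsStrictTotalOrder <-isStrictTotalOrder public
    using (irrefl; <-respˡ-≈; <-respʳ-≈; _≟_) renaming (trans to <-trans)
  open RingProperties ring public
    using (-0#≈0#; -‿involutive; -‿distribˡ-*; -‿distribʳ-*; -‿anti-homo-+; +-inverseˡ-unique)
  private module NonStrict = StrictToNonStrict _≈_ _<_

  <-strictPartialOrder : StrictPartialOrder c ℓ ℓ
  <-strictPartialOrder = record
    { isStrictPartialOrder = IsStrictTotalOrder.isStrictPartialOrder <-isStrictTotalOrder }

  module ≤-Reasoning = StrictPartialOrderReasoning <-strictPartialOrder

  <-irrefl : ∀ {a} → ¬ (a < a)
  <-irrefl = irrefl refl

  <⇒≉ : ∀ {a b} → a < b → a ≉ b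
  <⇒≉ a<b a≈b = irrefl a≈b a<b

  <-asym : ∀ {a b} → a < b → ¬ (b < a)
  <-asym a<b b<a = <-irrefl (<-trans a<b b<a)

  <-resp₂-≈ : ∀ {a b a' b'} → a ≈ a' → b ≈ b' → a < b → a' < b'
  <-resp₂-≈ a≈a' b≈b' = <-respˡ-≈ a≈a' ∘ <-respʳ-≈ b≈b'

  ≤-refl : ∀ {a} → a ≤ a
  ≤-refl = inj₂ refl

  ≤-trans : ∀ {a b d} → a ≤ b → b ≤ d → a ≤ d
  ≤-trans = NonStrict.trans isEquivalence (<-respʳ-≈ , <-respˡ-≈) <-trans

  ≤-antisym : ∀ {a b} → a ≤ b → b ≤ a → a ≈ b
  ≤-antisym = NonStrict.antisym isEquivalence <-trans irrefl

  ≤-resp₂-≈ : ∀ {a b a' b'} → a ≈ a' → b ≈ b' → a ≤ b → a' ≤ b'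
  ≤-resp₂-≈ a≈a' b≈b' =
    NonStrict.≤-respˡ-≈ sym trans <-respˡ-≈ a≈a' ∘ NonStrict.≤-respʳ-≈ trans <-respʳ-≈ b≈b'

  <-≤-trans : ∀ {a b d} → a < b → b ≤ d → a < d
  <-≤-trans = NonStrict.<-≤-trans <-trans <-respʳ-≈

  ≤-<-trans : ∀ {a b d} → a ≤ b → b < d → a < d
  ≤-<-trans = NonStrict.≤-<-trans sym <-trans <-respˡ-≈

  ≤⇒≯ : ∀ {a b} → a ≤ b → ¬ (b < a)
  ≤⇒≯ a≤b b<a = <-irrefl (≤-<-trans a≤b b<a)

  ≮⇒≥ : ∀ {a b} → ¬ (a < b) → b ≤ a
  ≮⇒≥ {a} {b} a≮b with compare a b
  ... | tri< a<b _ _ = ⊥-elim (a≮b a<b)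
  ... | tri≈ _ a≈b _ = inj₂ (sym a≈b)
  ... | tri> _ _ b<a = inj₁ b<a

  ≰⇒> : ∀ {a b} → ¬ (b ≤ a) → a < b
  ≰⇒> {a} {b} b≰a with compare a b
  ... | tri< a<b _ _ = a<b
  ... | tri≈ _ a≈b _ = ⊥-elim (b≰a (inj₂ (sym a≈b)))
  ... | tri> _ _ b<a = ⊥-elim (b≰a (inj₁ b<a))

  +-monoʳ-< : ∀ d {a b} → a < b → (d + a) < (d + b)
  +-monoʳ-< d {a} {b} a<b = <-resp₂-≈ (+-comm a d) (+-comm b d) (+-monoˡ-< d a<b)

  +-mono-≤-< : ∀ {a b x y} → a ≤ b → x < y → (a + x) < (b + y)
  +-mono-≤-< (inj₁ a<b) x<y = <-trans (+-monoˡ-< _ a<b) (+-monoʳ-< _ x<y)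
  +-mono-≤-< (inj₂ a≈b) x<y = <-respˡ-≈ (+-cong (sym a≈b) refl) (+-monoʳ-< _ x<y)

  +-mono-≤ : ∀ {a b x y} → a ≤ b → x ≤ y → (a + x) ≤ (b + y)
  +-mono-≤ a≤b (inj₁ x<y) = inj₁ (+-mono-≤-< a≤b x<y)
  +-mono-≤ (inj₁ a<b) (inj₂ x≈y) = inj₁ (<-respʳ-≈ (+-cong refl x≈y) (+-monoˡ-< _ a<b))
  +-mono-≤ (inj₂ a≈b) (inj₂ x≈y) = inj₂ (+-cong a≈b x≈y)

  a≉-b⇒a+b≉0 : ∀ {a b} → a ≉ (- b) → (a + b) ≉ 0#
  a≉-b⇒a+b≉0 {a} {b} a≉-b = a≉-b ∘ +-inverseˡ-unique a b

  a+b≉0⇒a≉-b : ∀ {a b} → (a + b) ≉ 0# → a ≉ (- b)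
  a+b≉0⇒a≉-b {a} {b} a+b≉0 a≈-b = a+b≉0 (trans (+-cong a≈-b refl) (-‿inverseˡ b))

  x+x≈2*x : ∀ x → x + x ≈ 2# * x
  x+x≈2*x x = sym (trans (distribʳ x 1# 1#) (+-cong (*-identityˡ x) (*-identityˡ x)))

  neg-antimono-< : ∀ {a b} → a < b → (- b) < (- a)
  neg-antimono-< {a} {b} a<b = <-resp₂-≈ a+[-a-b]≈-b b+[-a-b]≈-a (+-monoˡ-< (- a + - b) a<b)
    where
      open import Relation.Binary.Reasoning.Setoid setoid
      a+[-a-b]≈-b : a + (- a + - b) ≈ - b
      a+[-a-b]≈-b = begin
        a + (- a + - b) ≈⟨ +-assoc a (- a) (- b) ⟨
        (a + - a) + - b ≈⟨ +-cong (-‿inverseʳ a) refl ⟩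
        0# + - b        ≈⟨ +-identityˡ (- b) ⟩
        - b             ∎
      b+[-a-b]≈-a : b + (- a + - b) ≈ - a
      b+[-a-b]≈-a = begin
        b + (- a + - b) ≈⟨ +-cong refl (+-comm (- a) (- b)) ⟩
        b + (- b + - a) ≈⟨ +-assoc b (- b) (- a) ⟨
        (b + - b) + - a ≈⟨ +-cong (-‿inverseʳ b) refl ⟩
        0# + - a        ≈⟨ +-identityˡ (- a) ⟩
        - a             ∎

  neg-<0⇒>0 : ∀ {a} → a < 0# → 0# < (- a)
  neg-<0⇒>0 a<0 = <-respˡ-≈ -0#≈0# (neg-antimono-< a<0)

  <⇒0<- : ∀ {a b} → a < b → 0# < (b + - a)
  <⇒0<- {a} a<b = <-respˡ-≈ (-‿inverseʳ a) (+-monoˡ-< (- a) a<b)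

  0<-⇒< : ∀ {a b} → 0# < (b + - a) → a < b
  0<-⇒< {a} {b} 0<b-a = <-resp₂-≈ (+-identityˡ a) b-a+a≈b (+-monoˡ-< a 0<b-a)
    where
      b-a+a≈b : b + - a + a ≈ b
      b-a+a≈b = trans (+-assoc b (- a) a) (trans (+-cong refl (-‿inverseˡ a)) (+-identityʳ b))

  *-monoˡ-<-pos : ∀ {a b x} → 0# < x → a < b → (a * x) < (b * x)
  *-monoˡ-<-pos {a} {b} {x} 0<x a<b = 0<-⇒< (<-respʳ-≈ [b-a]x≈bx-ax (*-pos (<⇒0<- a<b) 0<x))
    where
      [b-a]x≈bx-ax : (b + - a) * x ≈ b * x + - (a * x)
      [b-a]x≈bx-ax = trans (distribʳ x b (- a)) (+-cong refl (sym (-‿distribˡ-* a x)))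

  *-monoʳ-<-pos : ∀ {a b x} → 0# < x → a < b → (x * a) < (x * b)
  *-monoʳ-<-pos {a} {b} {x} 0<x a<b = <-resp₂-≈ (*-comm a x) (*-comm b x) (*-monoˡ-<-pos 0<x a<b)

  *-monoˡ-≤-pos : ∀ {a b x} → 0# < x → a ≤ b → (a * x) ≤ (b * x)
  *-monoˡ-≤-pos 0<x (inj₁ a<b) = inj₁ (*-monoˡ-<-pos 0<x a<b)
  *-monoˡ-≤-pos 0<x (inj₂ a≈b) = inj₂ (*-cong a≈b refl)

  *-monoʳ-≤-pos : ∀ {a b x} → 0# < x → a ≤ b → (x * a) ≤ (x * b)
  *-monoʳ-≤-pos 0<x (inj₁ a<b) = inj₁ (*-monoʳ-<-pos 0<x a<b)
  *-monoʳ-≤-pos 0<x (inj₂ a≈b) = inj₂ (*-cong refl a≈b)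

  *-nonNeg : ∀ {a b} → 0# ≤ a → 0# ≤ b → 0# ≤ (a * b)
  *-nonNeg (inj₁ 0<a) (inj₁ 0<b) = inj₁ (*-pos 0<a 0<b)
  *-nonNeg {a} _ (inj₂ 0≈b) = inj₂ (trans (sym (zeroʳ a)) (*-cong refl 0≈b))
  *-nonNeg {b = b} (inj₂ 0≈a) (inj₁ _) = inj₂ (trans (sym (zeroˡ b)) (*-cong 0≈a refl))

  -x*-x≈x*x : ∀ x → - x * - x ≈ x * x
  -x*-x≈x*x x = begin
    - x * - x     ≈⟨ -‿distribˡ-* x (- x) ⟨
    - (x * - x)   ≈⟨ -‿cong (-‿distribʳ-* x x) ⟨
    - (- (x * x)) ≈⟨ -‿involutive (x * x) ⟩
    x * x         ∎
    where open import Relation.Binary.Reasoning.Setoid setoid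

  0<1 : 0# < 1#
  0<1 with compare 0# 1#
  ... | tri< 0<1 _ _ = 0<1
  ... | tri≈ _ 0≈1 _ = ⊥-elim (1≉0 (sym 0≈1))
  ... | tri> _ _ 1<0 = ⊥-elim (<-asym 1<0 (<-respʳ-≈ (trans (-x*-x≈x*x 1#) (*-identityˡ 1#)) 0<-1*-1))
    where
      0<-1*-1 : 0# < (- 1# * - 1#)
      0<-1*-1 = *-pos (neg-<0⇒>0 1<0) (neg-<0⇒>0 1<0)

  1<2 : 1# < 2#
  1<2 = <-respˡ-≈ (+-identityˡ 1#) (+-monoˡ-< 1# 0<1)

  0<2 : 0# < 2#
  0<2 = <-trans 0<1 1<2

  x<x*y : ∀ {x y} → 0# < x → 1# < y → x < (x * y)
  x<x*y {x} 0<x 1<y = <-respˡ-≈ (*-identityʳ x) (*-monoʳ-<-pos 0<x 1<y)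

  *-≉0 : ∀ {a b} → a ≉ 0# → b ≉ 0# → a * b ≉ 0#
  *-≉0 {a} {b} a≉0 b≉0 ab≈0 with inverse a a≉0
  ... | a⁻¹ , aa⁻¹≈1 = b≉0 (begin
    b              ≈⟨ *-identityʳ b ⟨
    b * 1#         ≈⟨ *-cong refl aa⁻¹≈1 ⟨
    b * (a * a⁻¹)  ≈⟨ solve 3 (λ a b i → b :* (a :* i) := (a :* b) :* i) refl a b a⁻¹ ⟩
    (a * b) * a⁻¹  ≈⟨ *-cong ab≈0 refl ⟩
    0# * a⁻¹       ≈⟨ zeroˡ a⁻¹ ⟩
    0#             ∎)
    where
      open import Relation.Binary.Reasoning.Setoid setoid
      open SemiringSolver commutativeSemiring using (solve; _:=_; _:*_)

  inverse-pos : ∀ {a b} → 0# < a → a * b ≈ 1# → 0# < b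
  inverse-pos {a} {b} 0<a ab≈1 with compare b 0#
  ... | tri> _ _ 0<b = 0<b
  ... | tri≈ _ b≈0 _ = ⊥-elim (1≉0 (trans (sym ab≈1) (trans (*-cong refl b≈0) (zeroʳ a))))
  ... | tri< b<0 _ _ = ⊥-elim (<-asym 0<1 (<-resp₂-≈ -[a*-b]≈1 -0#≈0# (neg-antimono-< (*-pos 0<a (neg-<0⇒>0 b<0)))))
    where
      -[a*-b]≈1 : - (a * - b) ≈ 1#
      -[a*-b]≈1 = trans (-‿cong (sym (-‿distribʳ-* a b))) (trans (-‿involutive (a * b)) ab≈1)

  inverse-<1 : ∀ {w j} → 1# < w → w * j ≈ 1# → j < 1#
  inverse-<1 {w} {j} 1<w wj≈1 = ≰⇒> λ 1≤j →
    ≤⇒≯ (≤-resp₂-≈ (*-identityʳ w) wj≈1 (*-monoʳ-≤-pos (<-trans 0<1 1<w) 1≤j)) 1<w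

  ∣∣-cases : ∀ a → (∣ a ∣ ≡ a × 0# ≤ a) ⊎ (∣ a ∣ ≡ - a × a < 0#)
  ∣∣-cases a with compare a 0#
  ... | tri< a<0 _ _ = inj₂ (≡.refl , a<0)
  ... | tri≈ _ a≈0 _ = inj₁ (≡.refl , inj₂ (sym a≈0))
  ... | tri> _ _ 0<a = inj₁ (≡.refl , inj₁ 0<a)

  ≡⇒≈ : ∀ {a b} → a ≡ b → a ≈ b
  ≡⇒≈ ≡.refl = refl

  ∣∣-nonNeg : ∀ a → 0# ≤ ∣ a ∣
  ∣∣-nonNeg a with ∣∣-cases a
  ... | inj₁ (∣a∣≡a , 0≤a) = ≤-resp₂-≈ refl (sym (≡⇒≈ ∣a∣≡a)) 0≤a
  ... | inj₂ (∣a∣≡-a , a<0) = inj₁ (<-respʳ-≈ (sym (≡⇒≈ ∣a∣≡-a)) (neg-<0⇒>0 a<0))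

  0≤⇒∣∣≈ : ∀ {a} → 0# ≤ a → ∣ a ∣ ≈ a
  0≤⇒∣∣≈ {a} 0≤a with ∣∣-cases a
  ... | inj₁ (∣a∣≡a , _) = ≡⇒≈ ∣a∣≡a
  ... | inj₂ (_ , a<0) = ⊥-elim (≤⇒≯ 0≤a a<0)

  ≉0⇒0<∣∣ : ∀ {a} → a ≉ 0# → 0# < ∣ a ∣
  ≉0⇒0<∣∣ {a} a≉0 with ∣∣-cases a
  ... | inj₁ (∣a∣≡a , inj₁ 0<a) = <-respʳ-≈ (sym (≡⇒≈ ∣a∣≡a)) 0<a
  ... | inj₁ (_ , inj₂ 0≈a) = ⊥-elim (a≉0 (sym 0≈a))
  ... | inj₂ (∣a∣≡-a , a<0) = <-respʳ-≈ (sym (≡⇒≈ ∣a∣≡-a)) (neg-<0⇒>0 a<0)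

  ∣a∣*∣a∣≈a*a : ∀ a → ∣ a ∣ * ∣ a ∣ ≈ a * a
  ∣a∣*∣a∣≈a*a a with ∣∣-cases a
  ... | inj₁ (∣a∣≡a , _) = *-cong (≡⇒≈ ∣a∣≡a) (≡⇒≈ ∣a∣≡a)
  ... | inj₂ (∣a∣≡-a , _) = trans (*-cong (≡⇒≈ ∣a∣≡-a) (≡⇒≈ ∣a∣≡-a)) (-x*-x≈x*x a)

  *-self-mono-< : ∀ {y z} → 0# ≤ y → y < z → (y * y) < (z * z)
  *-self-mono-< (inj₁ 0<y) y<z = <-trans (*-monoʳ-<-pos 0<y y<z) (*-monoˡ-<-pos (<-trans 0<y y<z) y<z)
  *-self-mono-< {z = z} (inj₂ 0≈y) y<z = <-respˡ-≈ (trans (sym (zeroˡ 0#)) (*-cong 0≈y 0≈y)) (*-pos 0<z 0<z)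
    where
      0<z : 0# < z
      0<z = <-respˡ-≈ (sym 0≈y) y<z

  *-self-injective-nonNeg : ∀ {y z} → 0# ≤ y → 0# ≤ z → y * y ≈ z * z → y ≈ z
  *-self-injective-nonNeg {y} {z} 0≤y 0≤z yy≈zz with compare y z
  ... | tri< y<z _ _ = ⊥-elim (<⇒≉ (*-self-mono-< 0≤y y<z) yy≈zz)
  ... | tri≈ _ y≈z _ = y≈z
  ... | tri> _ _ z<y = ⊥-elim (<⇒≉ (*-self-mono-< 0≤z z<y) (sym yy≈zz))

  -- ∣_∣ inspects the sign via compare, so it is no congruence for free; comparing squares
  -- avoids splitting on the signs of both sides.
  ∣∣-cong : ∀ {a b} → a ≈ b → ∣ a ∣ ≈ ∣ b ∣
  ∣∣-cong {a} {b} a≈b = *-self-injective-nonNeg (∣∣-nonNeg a) (∣∣-nonNeg b)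
    (trans (∣a∣*∣a∣≈a*a a) (trans (*-cong a≈b a≈b) (sym (∣a∣*∣a∣≈a*a b))))

  ∣-a∣≈∣a∣ : ∀ a → ∣ - a ∣ ≈ ∣ a ∣
  ∣-a∣≈∣a∣ a = *-self-injective-nonNeg (∣∣-nonNeg (- a)) (∣∣-nonNeg a)
    (trans (∣a∣*∣a∣≈a*a (- a)) (trans (-x*-x≈x*x a) (sym (∣a∣*∣a∣≈a*a a))))

  ∣a*b∣≈∣a∣*∣b∣ : ∀ a b → ∣ a * b ∣ ≈ ∣ a ∣ * ∣ b ∣
  ∣a*b∣≈∣a∣*∣b∣ a b = *-self-injective-nonNeg (∣∣-nonNeg (a * b)) (*-nonNeg (∣∣-nonNeg a) (∣∣-nonNeg b)) (begin
    ∣ a * b ∣ * ∣ a * b ∣             ≈⟨ ∣a∣*∣a∣≈a*a (a * b) ⟩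
    (a * b) * (a * b)                 ≈⟨ solve 2 (λ a b → (a :* b) :* (a :* b) := (a :* a) :* (b :* b)) refl a b ⟩
    (a * a) * (b * b)                 ≈⟨ *-cong (∣a∣*∣a∣≈a*a a) (∣a∣*∣a∣≈a*a b) ⟨
    (∣ a ∣ * ∣ a ∣) * (∣ b ∣ * ∣ b ∣) ≈⟨ solve 2 (λ x y → (x :* x) :* (y :* y) := (x :* y) :* (x :* y)) refl ∣ a ∣ ∣ b ∣ ⟩
    (∣ a ∣ * ∣ b ∣) * (∣ a ∣ * ∣ b ∣) ∎)
    where
      open import Relation.Binary.Reasoning.Setoid setoid
      open SemiringSolver commutativeSemiring using (solve; _:=_; _:*_)

  a≤∣a∣ : ∀ a → a ≤ ∣ a ∣
  a≤∣a∣ a with ∣∣-cases a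
  ... | inj₁ (∣a∣≡a , _) = inj₂ (sym (≡⇒≈ ∣a∣≡a))
  ... | inj₂ (∣a∣≡-a , a<0) = inj₁ (<-respʳ-≈ (sym (≡⇒≈ ∣a∣≡-a)) (<-trans a<0 (neg-<0⇒>0 a<0)))

  -a≤∣a∣ : ∀ a → (- a) ≤ ∣ a ∣
  -a≤∣a∣ a = ≤-resp₂-≈ refl (∣-a∣≈∣a∣ a) (a≤∣a∣ (- a))

  ∣a+b∣≤∣a∣+∣b∣ : ∀ a b → ∣ a + b ∣ ≤ (∣ a ∣ + ∣ b ∣)
  ∣a+b∣≤∣a∣+∣b∣ a b with ∣∣-cases (a + b)
  ... | inj₁ (∣a+b∣≡a+b , _) = ≤-resp₂-≈ (sym (≡⇒≈ ∣a+b∣≡a+b)) refl (+-mono-≤ (a≤∣a∣ a) (a≤∣a∣ b))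
  ... | inj₂ (∣a+b∣≡-[a+b] , _) = ≤-resp₂-≈ -a+-b≈∣a+b∣ refl (+-mono-≤ (-a≤∣a∣ a) (-a≤∣a∣ b))
    where
      -a+-b≈∣a+b∣ : - a + - b ≈ ∣ a + b ∣
      -a+-b≈∣a+b∣ = trans (+-comm (- a) (- b)) (trans (sym (-‿anti-homo-+ a b)) (sym (≡⇒≈ ∣a+b∣≡-[a+b])))

  max-cases : ∀ g h → (max g h ≡ g) ⊎ (max g h ≡ h)
  max-cases g h with compare g h
  ... | tri< _ _ _ = inj₂ ≡.refl
  ... | tri≈ _ _ _ = inj₁ ≡.refl
  ... | tri> _ _ _ = inj₁ ≡.refl

  x≤max[x,y] : ∀ g h → g ≤ max g h
  x≤max[x,y] g h with compare g h
  ... | tri< g<h _ _ = inj₁ g<h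
  ... | tri≈ _ _ _ = ≤-refl
  ... | tri> _ _ _ = ≤-refl

  y≤max[x,y] : ∀ g h → h ≤ max g h
  y≤max[x,y] g h with compare g h
  ... | tri< _ _ _ = ≤-refl
  ... | tri≈ _ g≈h _ = inj₂ (sym g≈h)
  ... | tri> _ _ h<g = inj₁ h<g

  max-lub : ∀ {g h x} → g ≤ x → h ≤ x → max g h ≤ x
  max-lub {g} {h} g≤x h≤x with max-cases g h
  ... | inj₁ max≡g = ≡.subst (_≤ _) (≡.sym max≡g) g≤x
  ... | inj₂ max≡h = ≡.subst (_≤ _) (≡.sym max≡h) h≤x

module DivisibleSubgroup {c ℓ p} (K : RealClosedField c ℓ) (G : Subgroup K p)
                         (divisible : Divisible K G) where
  open RealClosedField K
  open Subgroup G
  open OrderedFieldProperties K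
  open ≤-Reasoning

  ∈G⇒≉0 : ∀ {g} → g ∈G → g ≉ 0#
  ∈G⇒≉0 g∈G g≈0 = <⇒≉ (∈⇒pos g∈G) (sym g≈0)

  <⇒∃square-factor : ∀ {g g'} → g ∈G → g' ∈G → g < g' →
                     ∃ λ u → u ∈G × (1# < u) × ((g * (u * u)) ≈ g')
  <⇒∃square-factor {g} {g'} g∈G g'∈G g<g' with inv-closed g∈G
  ... | g⁻¹ , g⁻¹∈G , gg⁻¹≈1 with divisible (g' * g⁻¹) (*-closed g'∈G g⁻¹∈G) 1
  ... | u , u∈G , u*[u*1]≈g'g⁻¹ = u , u∈G , 1<u , gu²≈g'
    where
      open SemiringSolver commutativeSemiring using (solve; _:=_; _:*_)
      gu²≈g' : (g * (u * u)) ≈ g'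
      gu²≈g' = begin-equality
        g * (u * u)        ≈⟨ *-cong refl (*-cong refl (*-identityʳ u)) ⟨
        g * (u * (u * 1#)) ≈⟨ *-cong refl u*[u*1]≈g'g⁻¹ ⟩
        g * (g' * g⁻¹)     ≈⟨ solve 3 (λ g g' i → g :* (g' :* i) := g' :* (g :* i)) refl g g' g⁻¹ ⟩
        g' * (g * g⁻¹)     ≈⟨ *-cong refl gg⁻¹≈1 ⟩
        g' * 1#            ≈⟨ *-identityʳ g' ⟩
        g'                 ∎
      1<u : 1# < u
      1<u = ≰⇒> λ u≤1 → ≤⇒≯ (begin
        g'           ≈⟨ gu²≈g' ⟨
        g * (u * u)  ≤⟨ *-monoʳ-≤-pos (∈⇒pos g∈G) (*-monoʳ-≤-pos (∈⇒pos u∈G) u≤1) ⟩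
        g * (u * 1#) ≈⟨ *-cong refl (*-identityʳ u) ⟩
        g * u        ≤⟨ *-monoʳ-≤-pos (∈⇒pos g∈G) u≤1 ⟩
        g * 1#       ≈⟨ *-identityʳ g ⟩
        g            ∎) g<g'

  >1⇒∃sqrt : ∀ {h} → h ∈G → 1# < h → ∃ λ w → w ∈G × (1# < w) × ((w * w) ≈ h)
  >1⇒∃sqrt h∈G 1<h with <⇒∃square-factor 1∈ h∈G 1<h
  ... | w , w∈G , 1<w , 1*ww≈h = w , w∈G , 1<w , trans (sym (*-identityˡ _)) 1*ww≈h

  -- Since G is divisible, st(r) turns out to be the unique g ∈ G with Close r g; unlike the
  -- defining property of st, closeness is visibly multiplicative.
  Close : Carrier → Carrier → Set (c ⊔ ℓ ⊔ p)
  Close r g = ∀ u → u ∈G → 1# < u → (r < (g * u)) × (g < (r * u))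

  close-resp-≈ : ∀ {r r' g} → r ≈ r' → Close r g → Close r' g
  close-resp-≈ r≈r' r~g u u∈G 1<u =
    <-respˡ-≈ r≈r' (proj₁ (r~g u u∈G 1<u)) , <-respʳ-≈ (*-cong r≈r' refl) (proj₂ (r~g u u∈G 1<u))

  close-≤ : ∀ {r m k} → m ∈G → k ∈G → Close r k → (∀ u → u ∈G → 1# < u → r < (m * u)) → k ≤ m
  close-≤ {r} {m} {k} m∈G k∈G r~k r<m* = ≮⇒≥ m≮k
    where
      m≮k : ¬ (m < k)
      m≮k m<k with <⇒∃square-factor m∈G k∈G m<k
      ... | u , u∈G , 1<u , mu²≈k = <-irrefl (begin-strict
        k           <⟨ proj₂ (r~k u u∈G 1<u) ⟩
        r * u       <⟨ *-monoˡ-<-pos (∈⇒pos u∈G) (r<m* u u∈G 1<u) ⟩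
        (m * u) * u ≈⟨ *-assoc m u u ⟩
        m * (u * u) ≈⟨ mu²≈k ⟩
        k           ∎)

  close-unique : ∀ {r g g'} → g ∈G → g' ∈G → Close r g → Close r g' → g ≈ g'
  close-unique g∈G g'∈G r~g r~g' = ≤-antisym
    (close-≤ g'∈G g∈G r~g (λ u u∈G 1<u → proj₁ (r~g' u u∈G 1<u)))
    (close-≤ g∈G g'∈G r~g' (λ u u∈G 1<u → proj₁ (r~g u u∈G 1<u)))

  st⇒close : ∀ {r g} → 0# < r → IsSt K G r g → Close r g
  st⇒close {r} {g} 0<r (g∈G , inj₁ r≈g) u u∈G 1<u =
    <-respˡ-≈ (sym r≈g) (x<x*y 0<g 1<u) , <-respʳ-≈ (*-cong (sym r≈g) refl) (x<x*y 0<g 1<u)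
    where
      0<g : 0# < g
      0<g = ∈⇒pos g∈G
  st⇒close {r} {g} 0<r (g∈G , inj₂ (inj₁ (r<g , nothing-between))) u u∈G 1<u =
    <-trans r<g (x<x*y (∈⇒pos g∈G) 1<u) , ≰⇒> ru≰g
    where
      ru≰g : ¬ ((r * u) ≤ g)
      ru≰g ru≤g with >1⇒∃sqrt u∈G 1<u
      ... | w , w∈G , 1<w , ww≈u with inv-closed w∈G
      ... | w⁻¹ , w⁻¹∈G , ww⁻¹≈1 = nothing-between (g * w⁻¹) (*-closed g∈G w⁻¹∈G) (r<gw⁻¹ , gw⁻¹<g)
        where
          rw<g : (r * w) < g
          rw<g = begin-strict
            r * w       <⟨ x<x*y (*-pos 0<r (∈⇒pos w∈G)) 1<w ⟩
            (r * w) * w ≈⟨ *-assoc r w w ⟩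
            r * (w * w) ≈⟨ *-cong refl ww≈u ⟩
            r * u       ≤⟨ ru≤g ⟩
            g           ∎
          r<gw⁻¹ : r < (g * w⁻¹)
          r<gw⁻¹ = begin-strict
            r               ≈⟨ *-identityʳ r ⟨
            r * 1#          ≈⟨ *-cong refl ww⁻¹≈1 ⟨
            r * (w * w⁻¹)   ≈⟨ *-assoc r w w⁻¹ ⟨
            (r * w) * w⁻¹   <⟨ *-monoˡ-<-pos (inverse-pos (∈⇒pos w∈G) ww⁻¹≈1) rw<g ⟩
            g * w⁻¹         ∎
          gw⁻¹<g : (g * w⁻¹) < g
          gw⁻¹<g = <-respʳ-≈ (*-identityʳ g) (*-monoʳ-<-pos (∈⇒pos g∈G) (inverse-<1 1<w ww⁻¹≈1))
  st⇒close {r} {g} 0<r (g∈G , inj₂ (inj₂ (g<r , nothing-between))) u u∈G 1<u =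
    ≰⇒> gu≰r , <-trans g<r (x<x*y 0<r 1<u)
    where
      gu≰r : ¬ ((g * u) ≤ r)
      gu≰r gu≤r with >1⇒∃sqrt u∈G 1<u
      ... | w , w∈G , 1<w , ww≈u =
        nothing-between (g * w) (*-closed g∈G w∈G) (x<x*y (∈⇒pos g∈G) 1<w , gw<r)
        where
          gw<r : (g * w) < r
          gw<r = begin-strict
            g * w       <⟨ x<x*y (*-pos (∈⇒pos g∈G) (∈⇒pos w∈G)) 1<w ⟩
            (g * w) * w ≈⟨ *-assoc g w w ⟩
            g * (w * w) ≈⟨ *-cong refl ww≈u ⟩
            g * u       ≤⟨ gu≤r ⟩
            r           ∎

  st-unique : ∀ {r g g'} → 0# < r → IsSt K G r g → IsSt K G r g' → g ≈ g'
  st-unique 0<r st[r]≡g st[r]≡g' =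
    close-unique (proj₁ st[r]≡g) (proj₁ st[r]≡g') (st⇒close 0<r st[r]≡g) (st⇒close 0<r st[r]≡g')

  close-* : ∀ {a b g h} → 0# < a → 0# < b → g ∈G → h ∈G →
            Close a g → Close b h → Close (a * b) (g * h)
  close-* {a} {b} {g} {h} 0<a 0<b g∈G h∈G a~g b~h u u∈G 1<u with >1⇒∃sqrt u∈G 1<u
  ... | w , w∈G , 1<w , ww≈u = ab<ghu , gh<abu
    where
      open SemiringSolver commutativeSemiring using (solve; _:=_; _:*_)
      0<w : 0# < w
      0<w = ∈⇒pos w∈G
      [xw][yw]≈xyu : ∀ x y → ((x * w) * (y * w)) ≈ ((x * y) * u)
      [xw][yw]≈xyu x y = trans
        (solve 3 (λ x y w → (x :* w) :* (y :* w) := (x :* y) :* (w :* w)) refl x y w)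
        (*-cong refl ww≈u)
      ab<ghu : (a * b) < ((g * h) * u)
      ab<ghu = begin-strict
        a * b             <⟨ *-monoˡ-<-pos 0<b (proj₁ (a~g w w∈G 1<w)) ⟩
        (g * w) * b       <⟨ *-monoʳ-<-pos (*-pos (∈⇒pos g∈G) 0<w) (proj₁ (b~h w w∈G 1<w)) ⟩
        (g * w) * (h * w) ≈⟨ [xw][yw]≈xyu g h ⟩
        (g * h) * u       ∎
      gh<abu : (g * h) < ((a * b) * u)
      gh<abu = begin-strict
        g * h             <⟨ *-monoˡ-<-pos (∈⇒pos h∈G) (proj₂ (a~g w w∈G 1<w)) ⟩
        (a * w) * h       <⟨ *-monoʳ-<-pos (*-pos 0<a 0<w) (proj₂ (b~h w w∈G 1<w)) ⟩
        (a * w) * (b * w) ≈⟨ [xw][yw]≈xyu a b ⟩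
        (a * b) * u       ∎

module StandardPart {c ℓ p} (K : RealClosedField c ℓ) (G : Subgroup K p)
                    (divisible : Divisible K G) (tame : Tame K G) (cofinal : Cofinal K G) where
  open RealClosedField K
  open Subgroup G
  open OrderedFieldProperties K
  open DivisibleSubgroup K G divisible

  -- abstract, since otherwise with-abstraction over st-exists normalises its proof and
  -- exhausts memory.
  abstract
    -- Cofinality applied to r and to r⁻¹ brackets r between two elements of G, so tameness applies.
    st-exists : ∀ {r} → 0# < r → ∃ (IsSt K G r)
    st-exists {r} 0<r with cofinal r 0<r
    ... | g₂ , g₂∈G , r≤g₂ with inverse r (<⇒≉ 0<r ∘ sym)
    ... | r⁻¹ , rr⁻¹≈1 with cofinal r⁻¹ (inverse-pos 0<r rr⁻¹≈1)
    ... | g₃ , g₃∈G , r⁻¹≤g₃ with inv-closed g₃∈G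
    ... | g₁ , g₁∈G , g₃g₁≈1 = tame r 0<r g₁ g₂ g₁∈G g₂∈G g₁≤r r≤g₂
      where
        open SemiringSolver commutativeSemiring using (solve; _:=_; _:*_)
        open ≤-Reasoning
        g₁≤r : g₁ ≤ r
        g₁≤r = begin
          g₁              ≈⟨ *-identityˡ g₁ ⟨
          1# * g₁         ≈⟨ *-cong rr⁻¹≈1 refl ⟨
          (r * r⁻¹) * g₁  ≈⟨ solve 3 (λ r i g → (r :* i) :* g := i :* (r :* g)) refl r r⁻¹ g₁ ⟩
          r⁻¹ * (r * g₁)  ≤⟨ *-monoˡ-≤-pos (*-pos 0<r (∈⇒pos g₁∈G)) r⁻¹≤g₃ ⟩
          g₃ * (r * g₁)   ≈⟨ solve 3 (λ a r g → a :* (r :* g) := r :* (a :* g)) refl g₃ r g₁ ⟩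
          r * (g₃ * g₁)   ≈⟨ *-cong refl g₃g₁≈1 ⟩
          r * 1#          ≈⟨ *-identityʳ r ⟩
          r               ∎

  st-resp-≈ : ∀ {r r' g} → r ≈ r' → IsSt K G r g → IsSt K G r' g
  st-resp-≈ r≈r' (g∈G , inj₁ r≈g) = g∈G , inj₁ (trans (sym r≈r') r≈g)
  st-resp-≈ r≈r' (g∈G , inj₂ (inj₁ (r<g , nothing-between))) = g∈G , inj₂ (inj₁
    (<-respˡ-≈ r≈r' r<g , λ g' g'∈G (r'<g' , g'<g) → nothing-between g' g'∈G (<-respˡ-≈ (sym r≈r') r'<g' , g'<g)))
  st-resp-≈ r≈r' (g∈G , inj₂ (inj₂ (g<r , nothing-between))) = g∈G , inj₂ (inj₂
    (<-respʳ-≈ r≈r' g<r , λ g' g'∈G (g<g' , g'<r') → nothing-between g' g'∈G (g<g' , <-respʳ-≈ (sym r≈r') g'<r')))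

  vG-exists : ∀ {a} → a ≉ 0# → ∃ (vG K G a)
  vG-exists a≉0 = st-exists (≉0⇒0<∣∣ a≉0)

  vG-unique : ∀ {a g g'} → a ≉ 0# → vG K G a g → vG K G a g' → g ≈ g'
  vG-unique a≉0 = st-unique (≉0⇒0<∣∣ a≉0)

  vG-close : ∀ {a g} → a ≉ 0# → vG K G a g → Close ∣ a ∣ g
  vG-close a≉0 = st⇒close (≉0⇒0<∣∣ a≉0)

  vG-close-pos : ∀ {a g} → 0# < a → vG K G a g → Close a g
  vG-close-pos 0<a = close-resp-≈ (0≤⇒∣∣≈ (inj₁ 0<a)) ∘ vG-close (<⇒≉ 0<a ∘ sym)

  vG-self : ∀ {g} → g ∈G → vG K G g g
  vG-self g∈G = st-resp-≈ (sym (0≤⇒∣∣≈ (inj₁ (∈⇒pos g∈G)))) (g∈G , inj₁ refl)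

  vG-homo : ∀ a b g h k → a ≉ 0# → b ≉ 0# → vG K G a g → vG K G b h → vG K G (a * b) k → k ≈ (g * h)
  vG-homo a b g h k a≉0 b≉0 v[a]≡g v[b]≡h v[ab]≡k =
    close-unique (proj₁ v[ab]≡k) (*-closed (proj₁ v[a]≡g) (proj₁ v[b]≡h))
      (vG-close (*-≉0 a≉0 b≉0) v[ab]≡k)
      (close-resp-≈ (sym (∣a*b∣≈∣a∣*∣b∣ a b))
        (close-* (≉0⇒0<∣∣ a≉0) (≉0⇒0<∣∣ b≉0) (proj₁ v[a]≡g) (proj₁ v[b]≡h)
          (vG-close a≉0 v[a]≡g) (vG-close b≉0 v[b]≡h)))

  vG-surjective : ∀ g → g ∈G → ∃ λ a → a ≉ 0# × vG K G a g
  vG-surjective g g∈G = g , ∈G⇒≉0 g∈G , vG-self g∈G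

  vG-antitone : ∀ a b g h → 0# < a → a < b → vG K G a g → vG K G b h → _≤op_ K G h g
  vG-antitone a b g h 0<a a<b v[a]≡g v[b]≡h =
    close-≤ (proj₁ v[b]≡h) (proj₁ v[a]≡g) (vG-close-pos 0<a v[a]≡g)
      λ u u∈G 1<u → <-trans a<b (proj₁ (vG-close-pos (<-trans 0<a a<b) v[b]≡h u u∈G 1<u))

  minOp≡max : ∀ g h → minOp K G g h ≡ max g h
  minOp≡max g h with compare g h
  ... | tri< _ _ _ = ≡.refl
  ... | tri≈ _ _ _ = ≡.refl
  ... | tri> _ _ _ = ≡.refl

  max-∈G : ∀ {g h} → g ∈G → h ∈G → max g h ∈G
  max-∈G {g} {h} g∈G h∈G with max-cases g h
  ... | inj₁ max≡g = ≡.subst _∈G (≡.sym max≡g) g∈G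
  ... | inj₂ max≡h = ≡.subst _∈G (≡.sym max≡h) h∈G

  CondI⇒CondII : CondI K G → CondII K G
  CondI⇒CondII (_ , _ , ultrametric , _) a b g h k a≉0 b≉0 a≉-b v[a]≡g v[b]≡h v[a+b]≡k =
    ≡.subst (k ≤_) (minOp≡max g h) (ultrametric a b g h k a≉0 b≉0 a≉-b v[a]≡g v[b]≡h v[a+b]≡k)

  CondII⇒CondI : CondII K G → CondI K G
  CondII⇒CondI ultrametric = vG-homo , vG-surjective , ultrametricᵒᵖ , vG-antitone
    where
      ultrametricᵒᵖ : ∀ a b g h k → a ≉ 0# → b ≉ 0# → a ≉ (- b) →
                      vG K G a g → vG K G b h → vG K G (a + b) k → _≤op_ K G (minOp K G g h) k
      ultrametricᵒᵖ a b g h k a≉0 b≉0 a≉-b v[a]≡g v[b]≡h v[a+b]≡k =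
        ≡.subst (k ≤_) (≡.sym (minOp≡max g h)) (ultrametric a b g h k a≉0 b≉0 a≉-b v[a]≡g v[b]≡h v[a+b]≡k)

  CondII⇒CondIII : CondII K G → CondIII K G
  CondII⇒CondIII ultrametric g st[2]≡g = ≤-trans
    (ultrametric 1# 1# 1# 1# g 1≉0 1≉0 1≉-1 (vG-self 1∈) (vG-self 1∈)
      (st-resp-≈ (sym (0≤⇒∣∣≈ (inj₁ 0<2))) st[2]≡g))
    (max-lub ≤-refl ≤-refl)
    where
      1≉-1 : 1# ≉ (- 1#)
      1≉-1 = a+b≉0⇒a≉-b (<⇒≉ 0<2 ∘ sym)

  CondIII⇒2<-above-1 : CondIII K G → ∀ u → u ∈G → 1# < u → 2# < u
  CondIII⇒2<-above-1 st[2]≤1 u u∈G 1<u with st-exists 0<2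
  ... | g , st[2]≡g = begin-strict
    2#     <⟨ proj₁ (st⇒close 0<2 st[2]≡g u u∈G 1<u) ⟩
    g * u  ≤⟨ *-monoˡ-≤-pos (∈⇒pos u∈G) (st[2]≤1 g st[2]≡g) ⟩
    1# * u ≈⟨ *-identityˡ u ⟩
    u      ∎
    where open ≤-Reasoning

  -- Taking w with w² = u, the bound 2 < w absorbs the factor 2 from adding two terms below m·w.
  close-+-< : (∀ w → w ∈G → 1# < w → 2# < w) → ∀ {x y g h m} → m ∈G → Close x g → Close y h →
              g ≤ m → h ≤ m → ∀ u → u ∈G → 1# < u → (x + y) < (m * u)
  close-+-< 2<>1 {x} {y} {g} {h} {m} m∈G x~g y~h g≤m h≤m u u∈G 1<u with >1⇒∃sqrt u∈G 1<u
  ... | w , w∈G , 1<w , ww≈u = begin-strict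
    x + y               <⟨ +-mono-≤-< (inj₁ (below x~g g≤m)) (below y~h h≤m) ⟩
    (m * w) + (m * w)   ≈⟨ x+x≈2*x (m * w) ⟩
    2# * (m * w)        <⟨ *-monoˡ-<-pos (*-pos (∈⇒pos m∈G) (∈⇒pos w∈G)) (2<>1 w w∈G 1<w) ⟩
    w * (m * w)         ≈⟨ solve 2 (λ w m → w :* (m :* w) := m :* (w :* w)) refl w m ⟩
    m * (w * w)         ≈⟨ *-cong refl ww≈u ⟩
    m * u               ∎
    where
      open ≤-Reasoning
      open SemiringSolver commutativeSemiring using (solve; _:=_; _:*_)
      below : ∀ {z k} → Close z k → k ≤ m → z < (m * w)
      below z~k k≤m = <-≤-trans (proj₁ (z~k w w∈G 1<w)) (*-monoˡ-≤-pos (∈⇒pos w∈G) k≤m)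

  CondIII⇒CondII : CondIII K G → CondII K G
  CondIII⇒CondII st[2]≤1 a b g h k a≉0 b≉0 a≉-b v[a]≡g v[b]≡h v[a+b]≡k =
    close-≤ (max-∈G (proj₁ v[a]≡g) (proj₁ v[b]≡h)) (proj₁ v[a+b]≡k) (vG-close (a≉-b⇒a+b≉0 a≉-b) v[a+b]≡k)
      λ u u∈G 1<u → ≤-<-trans (∣a+b∣≤∣a∣+∣b∣ a b)
        (close-+-< (CondIII⇒2<-above-1 st[2]≤1) (max-∈G (proj₁ v[a]≡g) (proj₁ v[b]≡h))
          (vG-close a≉0 v[a]≡g) (vG-close b≉0 v[b]≡h) (x≤max[x,y] g h) (y≤max[x,y] g h) u u∈G 1<u)

  monomial : Monomial K G
  monomial = (λ g g∈G → g , vG-self g∈G)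
           , (λ g g' k k' m g∈G g'∈G → vG-homo g g' k k' m (∈G⇒≉0 g∈G) (∈G⇒≉0 g'∈G))
           , vG-injective
           , (λ h h∈G → h , h∈G , vG-self h∈G)
    where
      vG-injective : ∀ g g' k → g ∈G → g' ∈G → vG K G g k → vG K G g' k → g ≈ g'
      vG-injective g g' k g∈G g'∈G v[g]≡k v[g']≡k =
        trans (vG-unique (∈G⇒≉0 g∈G) (vG-self g∈G) v[g]≡k) (sym (vG-unique (∈G⇒≉0 g'∈G) (vG-self g'∈G) v[g']≡k))

  module ValuationRing (ultrametric : CondII K G) where
    V : Carrier → Set (c ⊔ ℓ ⊔ p)
    V = ValRing K G

    V-resp-≈ : ∀ {a b} → a ≈ b → V a → V b
    V-resp-≈ a≈b (inj₁ a≈0) = inj₁ (trans (sym a≈b) a≈0)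
    V-resp-≈ a≈b (inj₂ (a≉0 , v[a]≤1)) =
      inj₂ (a≉0 ∘ trans a≈b , λ g v[b]≡g → v[a]≤1 g (st-resp-≈ (∣∣-cong (sym a≈b)) v[b]≡g))

    vG≤1⇒V : ∀ {a g} → a ≉ 0# → vG K G a g → g ≤ 1# → V a
    vG≤1⇒V a≉0 v[a]≡g g≤1 = inj₂ (a≉0 , λ g' v[a]≡g' → ≤-resp₂-≈ (vG-unique a≉0 v[a]≡g v[a]≡g') refl g≤1)

    V-1 : V 1#
    V-1 = vG≤1⇒V 1≉0 (vG-self 1∈) ≤-refl

    V-+ : ∀ a b → V a → V b → V (a + b)
    V-+ a b (inj₁ a≈0) b∈V = V-resp-≈ (trans (sym (+-identityˡ b)) (+-cong (sym a≈0) refl)) b∈V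
    V-+ a b a∈V (inj₁ b≈0) = V-resp-≈ (trans (sym (+-identityʳ a)) (+-cong refl (sym b≈0))) a∈V
    V-+ a b (inj₂ (a≉0 , v[a]≤1)) (inj₂ (b≉0 , v[b]≤1)) with (a + b) ≟ 0#
    ... | yes a+b≈0 = inj₁ a+b≈0
    ... | no a+b≉0 with vG-exists a≉0 | vG-exists b≉0 | vG-exists a+b≉0
    ...   | g , v[a]≡g | h , v[b]≡h | k , v[a+b]≡k = vG≤1⇒V a+b≉0 v[a+b]≡k (≤-trans
            (ultrametric a b g h k a≉0 b≉0 (a+b≉0⇒a≉-b a+b≉0) v[a]≡g v[b]≡h v[a+b]≡k)
            (max-lub (v[a]≤1 g v[a]≡g) (v[b]≤1 h v[b]≡h)))

    V-neg : ∀ a → V a → V (- a)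
    V-neg a (inj₁ a≈0) = inj₁ (trans (-‿cong a≈0) -0#≈0#)
    V-neg a (inj₂ (a≉0 , v[a]≤1)) =
      inj₂ ((λ -a≈0 → a≉0 (trans (sym (-‿involutive a)) (trans (-‿cong -a≈0) -0#≈0#)))
           , λ g v[-a]≡g → v[a]≤1 g (st-resp-≈ (∣-a∣≈∣a∣ a) v[-a]≡g))

    V-* : ∀ a b → V a → V b → V (a * b)
    V-* a b (inj₁ a≈0) _ = inj₁ (trans (*-cong a≈0 refl) (zeroˡ b))
    V-* a b (inj₂ _) (inj₁ b≈0) = inj₁ (trans (*-cong refl b≈0) (zeroʳ a))
    V-* a b (inj₂ (a≉0 , v[a]≤1)) (inj₂ (b≉0 , v[b]≤1))
      with vG-exists a≉0 | vG-exists b≉0 | vG-exists (*-≉0 a≉0 b≉0)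
    ... | g , v[a]≡g | h , v[b]≡h | k , v[ab]≡k = vG≤1⇒V (*-≉0 a≉0 b≉0) v[ab]≡k (begin
      k      ≈⟨ vG-homo a b g h k a≉0 b≉0 v[a]≡g v[b]≡h v[ab]≡k ⟩
      g * h  ≤⟨ *-monoˡ-≤-pos (∈⇒pos (proj₁ v[b]≡h)) (v[a]≤1 g v[a]≡g) ⟩
      1# * h ≈⟨ *-identityˡ h ⟩
      h      ≤⟨ v[b]≤1 h v[b]≡h ⟩
      1#     ∎)
      where open ≤-Reasoning

    inverse-vG≤1 : ∀ a b g h → a ≉ 0# → b ≉ 0# → (a * b) ≈ 1# →
                   vG K G a g → vG K G b h → 1# < g → h ≤ 1#
    inverse-vG≤1 a b g h a≉0 b≉0 ab≈1 v[a]≡g v[b]≡h 1<g = ≮⇒≥ λ 1<h →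
      <⇒≉ (<-trans 1<g (x<x*y (∈⇒pos (proj₁ v[a]≡g)) 1<h))
        (vG-homo a b g h 1# a≉0 b≉0 v[a]≡g v[b]≡h (st-resp-≈ (∣∣-cong (sym ab≈1)) (vG-self 1∈)))

    V-or-inverse : ∀ a → a ≉ 0# → V a ⊎ (∀ b → (a * b) ≈ 1# → V b)
    V-or-inverse a a≉0 with vG-exists a≉0
    ... | g , v[a]≡g with compare 1# g
    ... | tri≈ _ 1≈g _ = inj₁ (vG≤1⇒V a≉0 v[a]≡g (inj₂ (sym 1≈g)))
    ... | tri> _ _ g<1 = inj₁ (vG≤1⇒V a≉0 v[a]≡g (inj₁ g<1))
    ... | tri< 1<g _ _ = inj₂ λ b ab≈1 →
      inj₂ (b≉0 ab≈1 , λ h v[b]≡h → inverse-vG≤1 a b g h a≉0 (b≉0 ab≈1) ab≈1 v[a]≡g v[b]≡h 1<g)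
      where
        b≉0 : ∀ {b} → (a * b) ≈ 1# → b ≉ 0#
        b≉0 {b} ab≈1 b≈0 = 1≉0 (trans (sym ab≈1) (trans (*-cong refl b≈0) (zeroʳ a)))

    V-convex : ∀ a b → 0# ≤ a → a ≤ b → V b → V a
    V-convex a b (inj₂ 0≈a) _ _ = inj₁ (sym 0≈a)
    V-convex a b (inj₁ 0<a) (inj₂ a≈b) b∈V = V-resp-≈ (sym a≈b) b∈V
    V-convex a b (inj₁ 0<a) (inj₁ a<b) (inj₁ b≈0) = ⊥-elim (<⇒≉ (<-trans 0<a a<b) (sym b≈0))
    V-convex a b (inj₁ 0<a) (inj₁ a<b) (inj₂ (b≉0 , v[b]≤1))
      with vG-exists (<⇒≉ 0<a ∘ sym) | vG-exists b≉0
    ... | g , v[a]≡g | h , v[b]≡h = vG≤1⇒V (<⇒≉ 0<a ∘ sym) v[a]≡g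
            (≤-trans (vG-antitone a b g h 0<a a<b v[a]≡g v[b]≡h) (v[b]≤1 h v[b]≡h))

    isConvexValuationRing : IsConvexValuationRing K G V
    isConvexValuationRing = V-resp-≈ , inj₁ refl , V-1 , V-+ , V-neg , V-* , V-or-inverse , V-convex

lemma4p3 : ∀ {c ℓ p} (K : RealClosedField c ℓ) (G : Subgroup K p) →
    Divisible K G → Tame K G → Cofinal K G →
    ((CondI K G → CondII K G) × (CondII K G → CondI K G))
    × ((CondII K G → CondIII K G) × (CondIII K G → CondII K G))
    × (CondI K G →
         Monomial K G
         × IsConvexValuationRing K G (ValRing K G)
         × (∀ a → (ValRing K G a → VG K G a) × (VG K G a → ValRing K G a)))
lemma4p3 K G divisible tame cofinal =
    (CondI⇒CondII , CondII⇒CondI)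
  , (CondII⇒CondIII , CondIII⇒CondII)
  , λ condI → monomial
            , ValuationRing.isConvexValuationRing (CondI⇒CondII condI)
            , λ a → id , id
  where open StandardPart K G divisible tame cofinal
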